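{- Let $\lambda\vdash n$, let $S\in\operatorname{SYT}(\lambda)$ and let $T$ be any filling of $\lambda$ using each element of $\mathbb{N}_n$ once. Then $\frac{1}{s_T^S}\sum_{\tau\in R(T)}\tau\, p_T^S$ is a sum of distinct monomials, each with coefficient $1$, one of which is $p_T^S$; all of these monomials have degree $\operatorname{cc}(S)$ and the same multiset of exponents. Moreover, for every monomial $q\neq p_T^S$ appearing in this sum and every $\sigma\in C(T)$, we have $\sigma q\neq p_T^S$.
   Context: $\mathbb{N}_m=\{1,\dots,m\}$; $S_n$ acts on $\mathbb{Q}[x_1,\dots,x_n]$ by $\sigma\cdot x_i=x_{\sigma(i)}$. Tableaux are in English notation; $\operatorname{SYT}(\lambda)$ is the set of standard Young tableaux of shape $\lambda$ with entries $\mathbb{N}_n$. For $S\in\operatorname{SYT}(\lambda)$ with $R_S(i),C_S(i)$ the row and column of $i$, $\operatorname{Dsi}(S)$ is the set of $i\in\mathbb{N}_{n-1}$ with $R_S(i+1)>R_S(i)$ and $C_S(i+1)\le C_S(i)$; $\operatorname{ct}(S)$ is obtained from $S$ by replacing each entry $p$ by $|\{j\in\operatorname{Dsi}(S):j<p\}|$, and $\operatorname{cc}(S)$ is the sum of the entries of $\operatorname{ct}(S)$. For a filling $T$ of $\lambda$ by $\mathbb{N}_n$, $R(T),C(T)\le S_n$ are the subgroups preserving each row, resp. each column, of $T$ as a set. $p_T^S=\prod_{i=1}^n x_i^{h_i}$, where $h_i$ is the entry of $\operatorname{ct}(S)$ in the box where $T$ has $i$, and $s_T^S$ is the number of $\tau\in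 R(T)$ with $\tau p_T^S=p_T^S$. -}

module Defs where

open import Data.Nat as ℕ using (ℕ; zero; suc; _<_; _≤_)
import Data.Nat.Properties as ℕP
open import Data.Fin as Fin using (Fin; toℕ)
import Data.Fin.Properties as FinP
open import Data.List as List using (List; []; _∷_; length; lookup; filter; allFin; concatMap; map)
open import Data.List.Relation.Unary.All using (All)
open import Data.Nat.ListAction using (sum)
open import Data.Vec as Vec using (Vec)
open import Data.Product using (Σ; _×_; _,_; proj₁; proj₂; ∃)
open import Function.Bundles using (_↔_; Inverse)
open import Relation.Binary.PropositionalEquality using (_≡_)
open import Relation.Nullary using (¬_; Dec)
open import Relation.Nullary.Decidable using (_×-dec_; _→-dec_)

record IsPartition (n : ℕ) (λ′ : List ℕ) : Set where
  field
    positive   : All (λ k → 0 < k) λ′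
    decreasing : ∀ (i j : Fin (length λ′)) → i Fin.≤ j → lookup λ′ j ≤ lookup λ′ i
    sums       : sum λ′ ≡ n

-- boxes of the Young diagram of λ: (row r, column c) with c < λ_r
-- (rows and columns are 0-based; English notation)
Box : List ℕ → Set
Box λ′ = Σ (Fin (length λ′)) (λ r → Fin (lookup λ′ r))

-- a filling of λ using each element of ℕ_n exactly once:
-- a bijection between entries and boxes.  Entry i : Fin n stands for i+1.
record Filling (n : ℕ) (λ′ : List ℕ) : Set where
  constructor filling
  field bij : Fin n ↔ Box λ′

module _ {n : ℕ} {λ′ : List ℕ} (T : Filling n λ′) where
  open Inverse (Filling.bij T)

  R : Fin n → ℕ
  R i = toℕ (proj₁ (to i))

  C : Fin n → ℕ
  C i = toℕ (proj₂ (to i))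

  entryAt : Box λ′ → Fin n
  entryAt = from

  IsStandard : Set
  IsStandard = ∀ (i j : Fin n) →
    (R i ≡ R j → C i < C j → i Fin.< j) × (C i ≡ C j → R i < R j → i Fin.< j)

  InDsi : Fin n → Set
  InDsi i = ∃ λ (j : Fin n) → toℕ j ≡ suc (toℕ i) × (R i < R j) × (C j ≤ C i)

  InDsi? : (i : Fin n) → Dec (InDsi i)
  InDsi? i = FinP.any? (λ j → (toℕ j ℕP.≟ suc (toℕ i)) ×-dec (R i ℕP.<? R j) ×-dec (C j ℕP.≤? C i))

  -- entry of ct(T) replacing entry i: |{ j ∈ Dsi(T) : j < i }|
  ct : Fin n → ℕ
  ct i = length (filter (λ j → (j FinP.<? i) ×-dec InDsi? j) (allFin n))

  cc : ℕ
  cc = sum (map ct (allFin n))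

-- monomial ∏ x_i^{e_i} represented by its exponent vector e
Monomial : ℕ → Set
Monomial n = Vec ℕ n

degree : ∀ {n} → Monomial n → ℕ
degree = Vec.sum

-- σ ∈ S_n, as an (injective, hence bijective) map Fin n → Fin n
IsPerm : ∀ {n} → (Fin n → Fin n) → Set
IsPerm {n} σ = ∀ (i j : Fin n) → σ i ≡ σ j → i ≡ j

IsPerm? : ∀ {n} (σ : Fin n → Fin n) → Dec (IsPerm σ)
IsPerm? σ = FinP.all? λ i → FinP.all? λ j → (σ i FinP.≟ σ j) →-dec (i FinP.≟ j)

-- all maps Fin k → Fin m, each listed exactly once
allFuns : (k m : ℕ) → List (Fin k → Fin m)
allFuns zero    m = (λ ()) ∷ []
allFuns (suc k) m = concatMap (λ f → map (λ a → cons a f) (allFin m)) (allFuns k m)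
  where
  cons : Fin m → (Fin k → Fin m) → Fin (suc k) → Fin m
  cons a f Fin.zero    = a
  cons a f (Fin.suc i) = f i

Sym : (n : ℕ) → List (Fin n → Fin n)
Sym n = filter IsPerm? (allFuns n n)

-- σ · e = q, where σ·x_i = x_{σ(i)}: the exponent of x_{σ(i)} in σ·e is e_i
Acts : ∀ {n} → (Fin n → Fin n) → Monomial n → Monomial n → Set
Acts σ e q = ∀ i → Vec.lookup q (σ i) ≡ Vec.lookup e i

Acts? : ∀ {n} (σ : Fin n → Fin n) (e q : Monomial n) → Dec (Acts σ e q)
Acts? σ e q = FinP.all? λ i → Vec.lookup q (σ i) ℕP.≟ Vec.lookup e i

module _ {n : ℕ} {λ′ : List ℕ} (T : Filling n λ′) where

  InRowGroup : (Fin n → Fin n) → Set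
  InRowGroup τ = ∀ i → R T (τ i) ≡ R T i

  InRowGroup? : (τ : Fin n → Fin n) → Dec (InRowGroup τ)
  InRowGroup? τ = FinP.all? λ i → R T (τ i) ℕP.≟ R T i

  InColGroup : (Fin n → Fin n) → Set
  InColGroup σ = ∀ i → C T (σ i) ≡ C T i

  -- coefficient of the monomial q in  Σ_{τ ∈ R(T)} τ e
  rowSumCoeff : Monomial n → Monomial n → ℕ
  rowSumCoeff e q =
    length (filter (λ τ → InRowGroup? τ ×-dec Acts? τ e q) (Sym n))

-- p_T^S = ∏ x_i^{h_i}, h_i = entry of ct(S) in the box where T has i
pTS : ∀ {n λ′} → (S T : Filling n λ′) → Monomial n
pTS S T = Vec.tabulate λ i → ct S (entryAt S (Inverse.to (Filling.bij T) i))

sTS : ∀ {n λ′} → (S T : Filling n λ′) → ℕ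
sTS S T = rowSumCoeff T (pTS S T) (pTS S T)

-- Every τ ∈ R(T) merely permutes the exponents of p = p_T^S, which gives the degree cc(S) and the
-- exponent multiset, and the τ ∈ R(T) with τ p = q form a coset of the stabiliser of p, so every
-- coefficient is 0 or s_T^S.  In a standard S there is an element of Dsi(S) between any two entries
-- of a column, so ct(S), and with it p, strictly increases down every column of T.  If a column
-- permutation σ sends q = τ p back to p, go down the rows of T: once σ fixes the rows above, it can
-- only move an entry of the current row downwards, so p ≤ q on that row; since τ preserves row sums,
-- p = q there, which forces σ to fix the row.

{-# OPTIONS --safe #-}
module Submission where

open import Defs
open import Data.Nat using (ℕ; zero; suc; _+_; _*_; _≤_; _<_)
open import Data.List as List using (List; []; _∷_; _++_; map; concatMap; tabulate; allFin; length; filter)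
open import Data.Vec as Vec using (Vec; []; _∷_; toList)
open import Data.Fin as Fin using (Fin; toℕ; fromℕ<; punchOut)
open import Data.Product using (∃; _×_; _,_; proj₁; proj₂)
open import Data.Sum using (_⊎_; inj₁; inj₂)
open import Data.List.Relation.Binary.Permutation.Propositional using (_↭_; module PermutationReasoning)
open import Relation.Binary.PropositionalEquality
open import Relation.Nullary using (¬_; Dec; yes; no; _because_; contradiction)

import Algebra.Properties.CommutativeMonoid.Sum as CommutativeMonoidSum
open import Data.Bool using (true; false)
import Data.Fin.Properties as FinP
open import Data.Fin.Permutation as Perm using (Permutation′; _⟨$⟩ʳ_)
import Data.List.Properties as LP
open import Data.List.Membership.Propositional using (_∈_; lose)
open import Data.List.Membership.Propositional.Properties using (∈-allFin; ∈-map⁺; ∈-concatMap⁺; ∈-filter⁺)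
open import Data.List.Relation.Unary.Any as LAny using (here; there)
import Data.List.Relation.Binary.Permutation.Propositional.Properties as ↭
import Data.Nat.Properties as ℕP
open import Data.Nat.ListAction using (sum)
open import Data.Nat.ListAction.Properties using (sum-++; sum-↭)
import Data.Vec.Functional as VF
import Data.Vec.Properties as VP
open import Function using (_∘_; id)
open import Function.Bundles using (_⇔_; mk⇔; Equivalence; Inverse)
open import Function.Properties.Inverse using (↔-trans; ↔-sym)
open import Relation.Binary using (_Preserves_⟶_; tri<; tri≈; tri>)
open import Relation.Nullary.Decidable using (_×-dec_)
open import Relation.Unary using (Decidable)

variable
  A : Set
  k m n : ℕ

IsPerm⇒surjective : {f : Fin n → Fin n} → IsPerm f → ∀ y → ∃ λ x → f x ≡ y
IsPerm⇒surjective {suc n} {f} f-inj y with FinP.any? (λ x → f x FinP.≟ y)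
... | yes hit = hit
... | no miss = contradiction (FinP.injective⇒≤ punchOut-injective) ℕP.1+n≰n
  where
  avoids : ∀ x → y ≢ f x
  avoids x y≡fx = miss (x , sym y≡fx)
  punchOut-injective : ∀ {x x′} → punchOut (avoids x) ≡ punchOut (avoids x′) → x ≡ x′
  punchOut-injective eq = f-inj _ _ (FinP.punchOut-injective (avoids _) (avoids _) eq)

IsPerm⇒Permutation : {f : Fin n → Fin n} → IsPerm f → Permutation′ n
IsPerm⇒Permutation {n} {f} f-inj = Perm.permutation f f⁻¹
  (λ y → proj₂ (IsPerm⇒surjective f-inj y))
  (λ x → f-inj _ _ (proj₂ (IsPerm⇒surjective f-inj (f x))))
  where
  f⁻¹ : Fin n → Fin n
  f⁻¹ y = proj₁ (IsPerm⇒surjective f-inj y)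

tabulate-↭ : (π : Permutation′ n) (f : Fin n → A) → tabulate f ↭ tabulate (f ∘ (π ⟨$⟩ʳ_))
tabulate-↭ {A = A} π f = begin
  tabulate f                      ≡⟨ singletons f ⟨
  Σ.sum (λ i → f i ∷ [])          ↭⟨ Σ.sum-permute (λ i → f i ∷ []) π ⟩
  Σ.sum (λ i → f (π ⟨$⟩ʳ i) ∷ []) ≡⟨ singletons (f ∘ (π ⟨$⟩ʳ_)) ⟩
  tabulate (f ∘ (π ⟨$⟩ʳ_))        ∎
  where
  module Σ = CommutativeMonoidSum (↭.++-commutativeMonoid {A = A})
  open PermutationReasoning
  singletons : ∀ {n} (g : Fin n → A) → Σ.sum (λ i → g i ∷ []) ≡ tabulate g
  singletons {zero}  g = refl
  singletons {suc n} g = cong (g Fin.zero ∷_) (singletons (g ∘ Fin.suc))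

sum-tabulate-mono : {f g : Fin n → ℕ} → (∀ i → f i ≤ g i) → sum (tabulate f) ≤ sum (tabulate g)
sum-tabulate-mono {zero}  f≤g = ℕP.≤-refl
sum-tabulate-mono {suc n} f≤g = ℕP.+-mono-≤ (f≤g Fin.zero) (sum-tabulate-mono (f≤g ∘ Fin.suc))

≤∧sum-≡⇒≡ : {f g : Fin n → ℕ} → (∀ i → f i ≤ g i) → sum (tabulate f) ≡ sum (tabulate g) →
  ∀ i → f i ≡ g i
≤∧sum-≡⇒≡ {suc n} {f} {g} f≤g sum≡ = pointwise
  where
  rest≤ : sum (tabulate (f ∘ Fin.suc)) ≤ sum (tabulate (g ∘ Fin.suc))
  rest≤ = sum-tabulate-mono (f≤g ∘ Fin.suc)
  head≡ : f Fin.zero ≡ g Fin.zero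
  head≡ = ℕP.≤∧≮⇒≡ (f≤g Fin.zero) (λ f0<g0 → ℕP.<⇒≢ (ℕP.+-mono-<-≤ f0<g0 rest≤) sum≡)
  pointwise : ∀ i → f i ≡ g i
  pointwise Fin.zero    = head≡
  pointwise (Fin.suc i) = ≤∧sum-≡⇒≡ (f≤g ∘ Fin.suc)
    (ℕP.+-cancelˡ-≡ (f Fin.zero) _ _ (trans sum≡ (cong (_+ _) (sym head≡)))) i

sum-map-concatMap : ∀ {B : Set} (f : B → ℕ) (h : A → List B) xs →
  sum (map f (concatMap h xs)) ≡ sum (map (λ x → sum (map f (h x))) xs)
sum-map-concatMap f h []       = refl
sum-map-concatMap f h (x ∷ xs) = begin
  sum (map f (h x ++ concatMap h xs))                ≡⟨ cong sum (LP.map-++ f (h x) _) ⟩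
  sum (map f (h x) ++ map f (concatMap h xs))        ≡⟨ sum-++ (map f (h x)) _ ⟩
  sum (map f (h x)) + sum (map f (concatMap h xs))   ≡⟨ cong (_ +_) (sum-map-concatMap f h xs) ⟩
  sum (map (λ x → sum (map f (h x))) (x ∷ xs))       ∎
  where open ≡-Reasoning

filter-filter-⊆ : {P Q : A → Set} (P? : Decidable P) (Q? : Decidable Q) → (∀ {x} → P x → Q x) →
  ∀ xs → filter P? (filter Q? xs) ≡ filter P? xs
filter-filter-⊆ P? Q? P⊆Q []       = refl
filter-filter-⊆ P? Q? P⊆Q (x ∷ xs) with Q? x
... | no ¬qx = trans (filter-filter-⊆ P? Q? P⊆Q xs) (sym (LP.filter-reject P? (¬qx ∘ P⊆Q)))
... | yes _ with P? x
...   | yes _ = cong (x ∷_) (filter-filter-⊆ P? Q? P⊆Q xs)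
...   | no  _ = filter-filter-⊆ P? Q? P⊆Q xs

length-filter-⊂ : {P Q : A → Set} (P? : Decidable P) (Q? : Decidable Q) → (∀ {x} → P x → Q x) →
  ∀ {x xs} → x ∈ xs → Q x → ¬ P x → length (filter P? xs) < length (filter Q? xs)
length-filter-⊂ P? Q? P⊆Q {xs = xs} x∈ qx ¬px =
  subst (_< _) (cong length (filter-filter-⊆ P? Q? P⊆Q xs))
    (LP.filter-notAll P? (filter Q? xs) (lose (∈-filter⁺ Q? x∈ qx) ¬px))

allFuns-complete : ∀ k (f : Fin k → Fin m) → ∃ λ g → g ∈ allFuns k m × g ≗ f
allFuns-complete zero    f = _ , here refl , λ ()
allFuns-complete (suc k) f with g , g∈ , g≗ ← allFuns-complete k (f ∘ Fin.suc) =
  _ , ∈-concatMap⁺ _ (LAny.map (λ { refl → ∈-map⁺ _ (∈-allFin (f Fin.zero)) }) g∈) ,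
  λ { Fin.zero → refl ; (Fin.suc i) → g≗ i }

sum-allFuns-suc : (F : (Fin (suc k) → Fin m) → ℕ) → F Preserves _≗_ ⟶ _≡_ →
  sum (map F (allFuns (suc k) m)) ≡ sum (map (λ g → sum (tabulate (λ a → F (a VF.∷ g)))) (allFuns k m))
sum-allFuns-suc {k} {m} F F-cong = trans (sum-map-concatMap F _ (allFuns k m))
  (cong sum (LP.map-cong (λ g → cong sum (trans (sym (LP.map-∘ (allFin m)))
    (trans (LP.map-tabulate id _) (LP.tabulate-cong λ a →
      -- allFuns extends g by a with a local function, which agrees with a VF.∷ g only pointwise
      F-cong λ { Fin.zero → refl ; (Fin.suc i) → refl })))) (allFuns k m)))

sum-allFuns-∘ : ∀ k (π : Permutation′ m) (F : (Fin k → Fin m) → ℕ) → F Preserves _≗_ ⟶ _≡_ →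
  sum (map F (allFuns k m)) ≡ sum (map (λ g → F ((π ⟨$⟩ʳ_) ∘ g)) (allFuns k m))
sum-allFuns-∘ zero    π F F-cong = cong (_+ 0) (F-cong λ ())
sum-allFuns-∘ (suc k) π F F-cong = begin
  sum (map F (allFuns (suc k) _))
    ≡⟨ sum-allFuns-suc F F-cong ⟩
  sum (map (λ g → sum (tabulate (λ a → F (a VF.∷ g)))) (allFuns k _))
    ≡⟨ sum-allFuns-∘ k π (λ g → sum (tabulate (λ a → F (a VF.∷ g))))
         (λ g≗ → cong sum (LP.tabulate-cong λ a → F-cong (∷-cong a g≗))) ⟩
  sum (map (λ g → sum (tabulate (λ a → F (a VF.∷ ((π ⟨$⟩ʳ_) ∘ g))))) (allFuns k _))
    ≡⟨ cong sum (LP.map-cong (λ g → trans (sum-↭ (tabulate-↭ π _))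
         (cong sum (LP.tabulate-cong λ a → F-cong (π∘∷ a g)))) (allFuns k _)) ⟩
  sum (map (λ g → sum (tabulate (λ a → F ((π ⟨$⟩ʳ_) ∘ (a VF.∷ g))))) (allFuns k _))
    ≡⟨ sum-allFuns-suc (λ g → F ((π ⟨$⟩ʳ_) ∘ g)) (λ g≗ → F-cong (cong (π ⟨$⟩ʳ_) ∘ g≗)) ⟨
  sum (map (λ g → F ((π ⟨$⟩ʳ_) ∘ g)) (allFuns (suc k) _)) ∎
  where
  open ≡-Reasoning
  ∷-cong : ∀ a {g g′ : Fin k → Fin _} → g ≗ g′ → (a VF.∷ g) ≗ (a VF.∷ g′)
  ∷-cong a g≗ Fin.zero    = refl
  ∷-cong a g≗ (Fin.suc i) = g≗ i
  π∘∷ : ∀ a (g : Fin k → Fin _) → ((π ⟨$⟩ʳ a) VF.∷ ((π ⟨$⟩ʳ_) ∘ g)) ≗ (π ⟨$⟩ʳ_) ∘ (a VF.∷ g)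
  π∘∷ a g Fin.zero    = refl
  π∘∷ a g (Fin.suc i) = refl

𝟙 : {P : Set} → Dec P → ℕ
𝟙 (true  because _) = 1
𝟙 (false because _) = 0

𝟙-⇔ : {P Q : Set} → P ⇔ Q → (P? : Dec P) (Q? : Dec Q) → 𝟙 P? ≡ 𝟙 Q?
𝟙-⇔ P⇔Q (yes p)  (yes q)  = refl
𝟙-⇔ P⇔Q (yes p)  (no ¬q) = contradiction (Equivalence.to P⇔Q p) ¬q
𝟙-⇔ P⇔Q (no ¬p) (yes q)  = contradiction (Equivalence.from P⇔Q q) ¬p
𝟙-⇔ P⇔Q (no ¬p) (no ¬q) = refl

count : {P : A → Set} → Decidable P → List A → ℕ
count P? xs = sum (map (𝟙 ∘ P?) xs)

module _ {P : A → Set} (P? : Decidable P) where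

  count≢0⇒∃ : ∀ xs → count P? xs ≢ 0 → ∃ P
  count≢0⇒∃ []       c≢0 = contradiction refl c≢0
  count≢0⇒∃ (x ∷ xs) c≢0 with P? x
  ... | yes px = x , px
  ... | no  _  = count≢0⇒∃ xs c≢0

  ∈⇒count≢0 : ∀ {x xs} → x ∈ xs → P x → count P? xs ≢ 0
  ∈⇒count≢0 {x} (here refl) px with P? x
  ... | yes _  = λ ()
  ... | no ¬px = contradiction px ¬px
  ∈⇒count≢0 {xs = y ∷ _} (there x∈) px = ∈⇒count≢0 x∈ px ∘ ℕP.m+n≡0⇒n≡0 (𝟙 (P? y))

  length-filter-filter : {Q : A → Set} (Q? : Decidable Q) → ∀ xs →
    length (filter P? (filter Q? xs)) ≡ count (λ x → Q? x ×-dec P? x) xs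
  length-filter-filter Q? []       = refl
  length-filter-filter Q? (x ∷ xs) with Q? x
  ... | no  _ = length-filter-filter Q? xs
  ... | yes _ with P? x
  ...   | yes _ = cong suc (length-filter-filter Q? xs)
  ...   | no  _ = length-filter-filter Q? xs

module _ {λ′ : List ℕ} (T : Filling n λ′) where

  RowPerm : Monomial n → Monomial n → (Fin n → Fin n) → Set
  RowPerm e q τ = IsPerm τ × InRowGroup T τ × Acts τ e q

  RowPerm? : ∀ e q → Decidable (RowPerm e q)
  RowPerm? e q τ = IsPerm? τ ×-dec InRowGroup? T τ ×-dec Acts? τ e q

  RowPerm-resp-≗ : ∀ {e q τ τ′} → τ ≗ τ′ → RowPerm e q τ → RowPerm e q τ′
  RowPerm-resp-≗ {q = q} τ≗τ′ (τ-inj , τ-row , τ-act) =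
    (λ i j eq → τ-inj i j (trans (τ≗τ′ i) (trans eq (sym (τ≗τ′ j))))) ,
    (λ i → trans (cong (R T) (sym (τ≗τ′ i))) (τ-row i)) ,
    (λ i → trans (cong (Vec.lookup q) (sym (τ≗τ′ i))) (τ-act i))

  RowPerm-∘ : ∀ {e q τ₀ τ} → RowPerm e q τ₀ → RowPerm e q (τ₀ ∘ τ) ⇔ RowPerm e e τ
  RowPerm-∘ {e} {q} {τ₀} {τ} (τ₀-inj , τ₀-row , τ₀-act) = mk⇔
    (λ (inj , row , act) →
      (λ i j eq → inj i j (cong τ₀ eq)) ,
      (λ i → trans (sym (τ₀-row (τ i))) (row i)) ,
      (λ i → trans (sym (τ₀-act (τ i))) (act i)))
    (λ (inj , row , act) →
      (λ i j eq → inj i j (τ₀-inj _ _ eq)) ,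
      (λ i → trans (τ₀-row (τ i)) (row i)) ,
      (λ i → trans (τ₀-act (τ i)) (act i)))

  rowSumCoeff≡count : ∀ e q → rowSumCoeff T e q ≡ count (RowPerm? e q) (allFuns n n)
  rowSumCoeff≡count e q = length-filter-filter (λ τ → InRowGroup? T τ ×-dec Acts? τ e q) IsPerm? (allFuns n n)

  rowSumCoeff≢0⇒RowPerm : ∀ e q → rowSumCoeff T e q ≢ 0 → ∃ (RowPerm e q)
  rowSumCoeff≢0⇒RowPerm e q c≢0 = count≢0⇒∃ (RowPerm? e q) (allFuns n n) (c≢0 ∘ trans (rowSumCoeff≡count e q))

  rowSumCoeff-self≢0 : ∀ e → rowSumCoeff T e e ≢ 0
  rowSumCoeff-self≢0 e with ι , ι∈ , ι≗id ← allFuns-complete n (id {A = Fin n}) =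
    ∈⇒count≢0 (RowPerm? e e) ι∈ (RowPerm-resp-≗ {e} {e} (sym ∘ ι≗id) id∈) ∘ trans (sym (rowSumCoeff≡count e e))
    where
    id∈ : RowPerm e e id
    id∈ = (λ i j eq → eq) , (λ i → refl) , (λ i → refl)

  rowSumCoeff-orbit : ∀ {e q τ₀} → RowPerm e q τ₀ → rowSumCoeff T e q ≡ rowSumCoeff T e e
  rowSumCoeff-orbit {e} {q} {τ₀} τ₀∈ = begin
    rowSumCoeff T e q
      ≡⟨ rowSumCoeff≡count e q ⟩
    count (RowPerm? e q) (allFuns n n)
      ≡⟨ sum-allFuns-∘ n π (𝟙 ∘ RowPerm? e q) 𝟙-cong ⟩
    sum (map (λ τ → 𝟙 (RowPerm? e q (τ₀ ∘ τ))) (allFuns n n))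
      ≡⟨ cong sum (LP.map-cong (λ τ → 𝟙-⇔ (RowPerm-∘ {e} {q} {τ = τ} τ₀∈) _ _) (allFuns n n)) ⟩
    count (RowPerm? e e) (allFuns n n)
      ≡⟨ rowSumCoeff≡count e e ⟨
    rowSumCoeff T e e
      ∎
    where
    open ≡-Reasoning
    π : Permutation′ n
    π = IsPerm⇒Permutation (proj₁ τ₀∈)
    𝟙-cong : (𝟙 ∘ RowPerm? e q) Preserves _≗_ ⟶ _≡_
    𝟙-cong τ≗τ′ = 𝟙-⇔ (mk⇔ (RowPerm-resp-≗ {e} {q} τ≗τ′) (RowPerm-resp-≗ {e} {q} (sym ∘ τ≗τ′)))
                      (RowPerm? e q _) (RowPerm? e q _)

Box-≡ : {λ′ : List ℕ} {b b′ : Box λ′} →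
  toℕ (proj₁ b) ≡ toℕ (proj₁ b′) → toℕ (proj₂ b) ≡ toℕ (proj₂ b′) → b ≡ b′
Box-≡ {b = r , c} r≡ c≡ with refl ← FinP.toℕ-injective r≡ = cong (r ,_) (FinP.toℕ-injective c≡)

module _ {λ′ : List ℕ} (T : Filling n λ′) where
  open Inverse (Filling.bij T)

  same-box⇒≡ : ∀ {i j} → R T i ≡ R T j → C T i ≡ C T j → i ≡ j
  same-box⇒≡ {i} {j} R≡ C≡ = begin
    i             ≡⟨ strictlyInverseʳ i ⟨
    from (to i)   ≡⟨ cong from (Box-≡ {λ′} R≡ C≡) ⟩
    from (to j)   ≡⟨ strictlyInverseʳ j ⟩
    j             ∎
    where open ≡-Reasoning

  corner : IsPartition n λ′ → ∀ {i j} → R T i ≤ R T j → ∃ λ e → R T e ≡ R T i × C T e ≡ C T j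
  corner shape {i} {j} Ri≤Rj =
    from (r , fromℕ< c<) , cong (toℕ ∘ proj₁) (strictlyInverseˡ _) ,
    trans (cong (toℕ ∘ proj₂) (strictlyInverseˡ _)) (FinP.toℕ-fromℕ< c<)
    where
    r : Fin (length λ′)
    r = proj₁ (to i)
    c< : C T j < List.lookup λ′ r
    c< = ℕP.<-≤-trans (FinP.toℕ<n (proj₂ (to j))) (IsPartition.decreasing shape r (proj₁ (to j)) Ri≤Rj)

module _ {λ′ : List ℕ} (shape : IsPartition n λ′) (S : Filling n λ′) (S-std : IsStandard S) where

  row-≤ : ∀ {a b} → R S a ≡ R S b → C S a ≤ C S b → toℕ a ≤ toℕ b
  row-≤ {a} {b} R≡ C≤ with ℕP.m≤n⇒m<n∨m≡n C≤
  ... | inj₁ C< = ℕP.<⇒≤ (proj₁ (S-std a b) R≡ C<)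
  ... | inj₂ C≡ = ℕP.≤-reflexive (cong toℕ (same-box⇒≡ S R≡ C≡))

  column-≤ : ∀ {a b} → C S a ≡ C S b → R S a ≤ R S b → toℕ a ≤ toℕ b
  column-≤ {a} {b} C≡ R≤ with ℕP.m≤n⇒m<n∨m≡n R≤
  ... | inj₁ R< = ℕP.<⇒≤ (proj₂ (S-std a b) C≡ R<)
  ... | inj₂ R≡ = ℕP.≤-reflexive (cong toℕ (same-box⇒≡ S R≡ C≡))

  -- If j+1 were weakly left of and weakly above j, the box in the row of j+1 and the column of j
  -- would hold an entry e with j+1 ≤ e ≤ j.
  ∉Dsi⇒C< : ∀ {j j′} → toℕ j′ ≡ suc (toℕ j) → ¬ InDsi S j → C S j < C S j′
  ∉Dsi⇒C< {j} {j′} j′≡ j∉Dsi with C S j′ ℕP.≤? C S j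
  ... | no C≰ = ℕP.≰⇒> C≰
  ... | yes C≤ with R S j ℕP.<? R S j′
  ...   | yes R< = contradiction (j′ , j′≡ , R< , C≤) j∉Dsi
  ...   | no R≮ with e , Re≡ , Ce≡ ← corner S shape (ℕP.≮⇒≥ R≮) =
    contradiction (subst (_≤ toℕ j) j′≡ (ℕP.≤-trans j′≤e e≤j)) ℕP.1+n≰n
    where
    j′≤e : toℕ j′ ≤ toℕ e
    j′≤e = row-≤ (sym Re≡) (ℕP.≤-trans C≤ (ℕP.≤-reflexive (sym Ce≡)))
    e≤j : toℕ e ≤ toℕ j
    e≤j = column-≤ Ce≡ (ℕP.≤-trans (ℕP.≤-reflexive Re≡) (ℕP.≮⇒≥ R≮))

  no-Dsi⇒C< : ∀ k {a b} → suc (toℕ a) + k ≡ toℕ b →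
    (∀ d → toℕ a ≤ toℕ d → toℕ d < toℕ b → ¬ InDsi S d) → C S a < C S b
  no-Dsi⇒C< zero {a} {b} b≡ no-Dsi =
    ∉Dsi⇒C< (trans (sym b≡) (cong suc (ℕP.+-identityʳ _))) (no-Dsi a ℕP.≤-refl a<b)
    where
    a<b : toℕ a < toℕ b
    a<b = ℕP.≤-reflexive (trans (cong suc (sym (ℕP.+-identityʳ _))) b≡)
  no-Dsi⇒C< (suc k) {a} {b} b≡ no-Dsi =
    ℕP.<-trans (no-Dsi⇒C< k (sym b′≡) (λ d a≤d d<b′ → no-Dsi d a≤d (ℕP.<-trans d<b′ b′<b)))
               (∉Dsi⇒C< (trans b≡suc-m (cong suc (sym b′≡))) (no-Dsi b′ a≤b′ b′<b))
    where
    b≡suc-m : toℕ b ≡ suc (suc (toℕ a) + k)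
    b≡suc-m = trans (sym b≡) (cong suc (ℕP.+-suc (toℕ a) k))
    b′ : Fin n
    b′ = fromℕ< (ℕP.<-trans (ℕP.≤-reflexive (sym b≡suc-m)) (FinP.toℕ<n b))
    b′≡ : toℕ b′ ≡ suc (toℕ a) + k
    b′≡ = FinP.toℕ-fromℕ< _
    b′<b : toℕ b′ < toℕ b
    b′<b = ℕP.≤-reflexive (trans (cong suc b′≡) (sym b≡suc-m))
    a≤b′ : toℕ a ≤ toℕ b′
    a≤b′ = subst (toℕ a ≤_) (sym b′≡) (ℕP.m≤n⇒m≤1+n (ℕP.m≤m+n (toℕ a) k))

  ct-column-< : ∀ {a b} → C S a ≡ C S b → R S a < R S b → ct S a < ct S b
  ct-column-< {a} {b} C≡ R<
    with a<b ← proj₂ (S-std a b) C≡ R<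
       | FinP.any? (λ d → (toℕ a ℕP.≤? toℕ d) ×-dec (d FinP.<? b) ×-dec InDsi? S d)
  ... | yes (d , a≤d , d<b , d∈Dsi) =
    length-filter-⊂ _ _ (λ (j<a , j∈Dsi) → ℕP.<-trans j<a a<b , j∈Dsi) (∈-allFin d) (d<b , d∈Dsi)
      (λ (d<a , _) → ℕP.<⇒≱ d<a a≤d)
  ... | no ∄Dsi with k , k≡ ← ℕP.m≤n⇒∃[o]m+o≡n a<b =
    contradiction C≡ (ℕP.<⇒≢ (no-Dsi⇒C< k k≡ λ d a≤d d<b d∈Dsi → ∄Dsi (d , a≤d , d<b , d∈Dsi)))

toList≡tabulate : (v : Vec A n) → toList v ≡ tabulate (Vec.lookup v)
toList≡tabulate []       = refl
toList≡tabulate (x ∷ v) = cong (x ∷_) (toList≡tabulate v)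

degree≡sum-toList : (v : Monomial n) → degree v ≡ sum (toList v)
degree≡sum-toList []       = refl
degree≡sum-toList (x ∷ v) = cong (x +_) (degree≡sum-toList v)

Acts⇒↭ : ∀ {τ} {e q : Monomial n} → IsPerm τ → Acts τ e q → toList q ↭ toList e
Acts⇒↭ {τ = τ} {e} {q} τ-inj τ-act = begin
  toList q                      ≡⟨ toList≡tabulate q ⟩
  tabulate (Vec.lookup q)       ↭⟨ tabulate-↭ (IsPerm⇒Permutation τ-inj) (Vec.lookup q) ⟩
  tabulate (Vec.lookup q ∘ τ)   ≡⟨ LP.tabulate-cong τ-act ⟩
  tabulate (Vec.lookup e)       ≡⟨ toList≡tabulate e ⟨
  toList e                      ∎
  where open PermutationReasoning

↭⇒degree-≡ : {e q : Monomial n} → toList q ↭ toList e → degree q ≡ degree e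
↭⇒degree-≡ {e = e} {q} q↭e = trans (degree≡sum-toList q) (trans (sum-↭ q↭e) (sym (degree≡sum-toList e)))

module _ {λ′ : List ℕ} (S T : Filling n λ′) where

  sameBox : Permutation′ n
  sameBox = ↔-trans (Filling.bij T) (↔-sym (Filling.bij S))

  lookup-pTS : ∀ i → Vec.lookup (pTS S T) i ≡ ct S (sameBox ⟨$⟩ʳ i)
  lookup-pTS = VP.lookup∘tabulate _

  degree-pTS : degree (pTS S T) ≡ cc S
  degree-pTS = begin
    degree (pTS S T)                          ≡⟨ degree≡sum-toList (pTS S T) ⟩
    sum (toList (pTS S T))                    ≡⟨ cong sum (toList≡tabulate (pTS S T)) ⟩
    sum (tabulate (Vec.lookup (pTS S T)))     ≡⟨ cong sum (LP.tabulate-cong lookup-pTS) ⟩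
    sum (tabulate (ct S ∘ (sameBox ⟨$⟩ʳ_)))   ≡⟨ sum-↭ (tabulate-↭ sameBox (ct S)) ⟨
    sum (tabulate (ct S))                     ≡⟨ cong sum (LP.map-tabulate id (ct S)) ⟨
    cc S                                      ∎
    where open ≡-Reasoning

  sameBox-to : ∀ i → Inverse.to (Filling.bij S) (sameBox ⟨$⟩ʳ i) ≡ Inverse.to (Filling.bij T) i
  sameBox-to i = Inverse.strictlyInverseˡ (Filling.bij S) _

  pTS-column-< : IsPartition n λ′ → IsStandard S →
    ∀ {i j} → C T i ≡ C T j → R T i < R T j → Vec.lookup (pTS S T) i < Vec.lookup (pTS S T) j
  pTS-column-< shape S-std {i} {j} C≡ R< =
    subst₂ _<_ (sym (lookup-pTS i)) (sym (lookup-pTS j)) (ct-column-< shape S S-std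
      (trans (C-sameBox i) (trans C≡ (sym (C-sameBox j))))
      (subst₂ _<_ (sym (R-sameBox i)) (sym (R-sameBox j)) R<))
    where
    R-sameBox : ∀ i → R S (sameBox ⟨$⟩ʳ i) ≡ R T i
    R-sameBox i = cong (toℕ ∘ proj₁) (sameBox-to i)
    C-sameBox : ∀ i → C S (sameBox ⟨$⟩ʳ i) ≡ C T i
    C-sameBox i = cong (toℕ ∘ proj₂) (sameBox-to i)

module _ {λ′ : List ℕ} (T : Filling n λ′) {p q : Fin n → ℕ}
         {τ : Fin n → Fin n} (τ-inj : IsPerm τ) (τ-row : InRowGroup T τ) (τ-act : ∀ i → q (τ i) ≡ p i) where

  private
    inRow : ℕ → Fin n → ℕ
    inRow r i = 𝟙 (R T i ℕP.≟ r)

    row-sum-≡ : ∀ r → sum (tabulate (λ i → inRow r i * p i)) ≡ sum (tabulate (λ i → inRow r i * q i))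
    row-sum-≡ r = sym (begin
      sum (tabulate (λ i → inRow r i * q i))             ≡⟨ sum-↭ (tabulate-↭ (IsPerm⇒Permutation τ-inj) _) ⟩
      sum (tabulate (λ i → inRow r (τ i) * q (τ i)))     ≡⟨ cong sum (LP.tabulate-cong λ i →
                                                             cong₂ _*_ (cong (λ r′ → 𝟙 (r′ ℕP.≟ r)) (τ-row i)) (τ-act i)) ⟩
      sum (tabulate (λ i → inRow r i * p i))             ∎)
      where open ≡-Reasoning

    inRow-≤ : ∀ r → (∀ j → R T j ≡ r → p j ≤ q j) → ∀ i → inRow r i * p i ≤ inRow r i * q i
    inRow-≤ r p≤q i with R T i ℕP.≟ r
    ... | yes i∈r = ℕP.+-monoˡ-≤ 0 (p≤q i i∈r)
    ... | no  _   = ℕP.≤-refl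

  row-rearrangement-≤⇒≡ : ∀ r → (∀ j → R T j ≡ r → p j ≤ q j) → ∀ j → R T j ≡ r → p j ≡ q j
  row-rearrangement-≤⇒≡ r p≤q j j∈r with R T j ℕP.≟ r | ≤∧sum-≡⇒≡ (inRow-≤ r p≤q) (row-sum-≡ r) j
  ... | yes _    | pj+0≡qj+0 = ℕP.+-cancelʳ-≡ 0 _ _ pj+0≡qj+0
  ... | no  j∉r | _         = contradiction j∈r j∉r

  module _ (p-column-< : ∀ {i j} → C T i ≡ C T j → R T i < R T j → p i < p j)
           {σ : Fin n → Fin n} (σ-inj : IsPerm σ) (σ-col : InColGroup T σ) (σ-act : ∀ i → p (σ i) ≡ q i) where

    private
      fixed-or-increasing : ∀ r → (∀ j → R T j < r → σ j ≡ j) → ∀ j → R T j ≡ r → σ j ≡ j ⊎ p j < q j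
      fixed-or-increasing r fixed-above j j∈r with ℕP.<-cmp (R T (σ j)) r
      ... | tri< σj-above _ _ = inj₁ (σ-inj _ _ (fixed-above (σ j) σj-above))
      ... | tri≈ _ σj∈r _     = inj₁ (same-box⇒≡ T (trans σj∈r (sym j∈r)) (σ-col j))
      ... | tri> _ _ σj-below = inj₂ (subst (p j <_) (σ-act j)
                                  (p-column-< (sym (σ-col j)) (subst (_< R T (σ j)) (sym j∈r) σj-below)))

      p≤q-on-row : ∀ r → (∀ j → R T j < r → σ j ≡ j) → ∀ j → R T j ≡ r → p j ≤ q j
      p≤q-on-row r fixed-above j j∈r with fixed-or-increasing r fixed-above j j∈r
      ... | inj₁ σj≡j  = ℕP.≤-reflexive (trans (cong p (sym σj≡j)) (σ-act j))
      ... | inj₂ pj<qj = ℕP.<⇒≤ pj<qj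

      fixes-row : ∀ r → (∀ j → R T j < r → σ j ≡ j) → ∀ j → R T j ≡ r → σ j ≡ j
      fixes-row r fixed-above j j∈r with fixed-or-increasing r fixed-above j j∈r
      ... | inj₁ σj≡j  = σj≡j
      ... | inj₂ pj<qj =
        contradiction (row-rearrangement-≤⇒≡ r (p≤q-on-row r fixed-above) j j∈r) (ℕP.<⇒≢ pj<qj)

      fixes-above : ∀ r j → R T j < r → σ j ≡ j
      fixes-above (suc r) j j-above with ℕP.m≤n⇒m<n∨m≡n (ℕP.m<1+n⇒m≤n j-above)
      ... | inj₁ j-above′ = fixes-above r j j-above′
      ... | inj₂ j∈r      = fixes-row r (fixes-above r) j j∈r

    row-and-column-rearrangement⇒≗ : ∀ i → q i ≡ p i
    row-and-column-rearrangement⇒≗ i =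
      trans (sym (σ-act i)) (cong p (fixes-above (suc (R T i)) i (ℕP.n<1+n (R T i))))

lemma2p5 : ∀ (n : ℕ) (λ′ : List ℕ) → IsPartition n λ′ →
  (S T : Filling n λ′) → IsStandard S →
  -- every coefficient of (1/s) Σ_{τ∈R(T)} τ p is 0 or 1
  (∀ (q : Monomial n) → rowSumCoeff T (pTS S T) q ≡ 0 ⊎ rowSumCoeff T (pTS S T) q ≡ sTS S T)
  -- p_T^S occurs (with coefficient s/s = 1)
  × rowSumCoeff T (pTS S T) (pTS S T) ≢ 0
  -- every occurring monomial has degree cc(S) and the same multiset of exponents as p
  × (∀ (q : Monomial n) → rowSumCoeff T (pTS S T) q ≢ 0 →
       degree q ≡ cc S × toList q ↭ toList (pTS S T))
  -- no column permutation sends an occurring q ≠ p to p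
  × (∀ (q : Monomial n) → rowSumCoeff T (pTS S T) q ≢ 0 → q ≢ pTS S T →
       ∀ (σ : Fin n → Fin n) → IsPerm σ → InColGroup T σ → ¬ Acts σ q (pTS S T))
lemma2p5 n λ′ shape S T S-std =
  coefficient , rowSumCoeff-self≢0 T p , degree-and-exponents , column-separated
  where
  p : Monomial n
  p = pTS S T

  coefficient : ∀ q → rowSumCoeff T p q ≡ 0 ⊎ rowSumCoeff T p q ≡ sTS S T
  coefficient q with rowSumCoeff T p q ℕP.≟ 0
  ... | yes c≡0 = inj₁ c≡0
  ... | no  c≢0 = inj₂ (rowSumCoeff-orbit T {p} {q} (proj₂ (rowSumCoeff≢0⇒RowPerm T p q c≢0)))

  degree-and-exponents : ∀ q → rowSumCoeff T p q ≢ 0 → degree q ≡ cc S × toList q ↭ toList p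
  degree-and-exponents q c≢0 with _ , τ-inj , _ , τ-act ← rowSumCoeff≢0⇒RowPerm T p q c≢0 =
    trans (↭⇒degree-≡ q↭p) (degree-pTS S T) , q↭p
    where
    q↭p : toList q ↭ toList p
    q↭p = Acts⇒↭ τ-inj τ-act

  column-separated : ∀ q → rowSumCoeff T p q ≢ 0 → q ≢ p →
    ∀ σ → IsPerm σ → InColGroup T σ → ¬ Acts σ q p
  column-separated q c≢0 q≢p σ σ-inj σ-col σ-act
    with _ , τ-inj , τ-row , τ-act ← rowSumCoeff≢0⇒RowPerm T p q c≢0 = q≢p q≡p
    where
    q≗p : ∀ i → Vec.lookup q i ≡ Vec.lookup p i
    q≗p = row-and-column-rearrangement⇒≗ T τ-inj τ-row τ-act (pTS-column-< S T shape S-std)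
            σ-inj σ-col σ-act
    q≡p : q ≡ p
    q≡p = trans (sym (VP.tabulate∘lookup q)) (trans (VP.tabulate-cong q≗p) (VP.tabulate∘lookup p))
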